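{- Let $n\ge r\ge 5$ and let $G$ be a graph on $n$ vertices with an edge-coloring making it $C_r$-rainbow saturated. Let $u\in V(G)$ with $d(u)=2$ and $N(u)=\{v,w\}$, where $d(v)\le d(w)$. Then exactly one of the following holds: (1) $d(v)\ge 3$; (2) $d(v)=2$ and $N(v)=\{u,w\}$.
   Context: All graphs are finite, simple and undirected. An edge-coloring is a function $E(G)\to\mathbb{N}$; a (sub)graph is rainbow if its edges have distinct colors. An edge-colored graph is $C_r$-rainbow saturated if it contains no rainbow cycle on $r$ vertices but adding any nonedge with any color creates a rainbow cycle on $r$ vertices. -}

module Defs where

open import Data.Nat using (ℕ; zero; suc; _≤_; NonZero)
open import Data.Nat.DivMod using (_%_; m%n<n)
open import Data.Fin using (Fin; toℕ; fromℕ<)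
open import Data.Fin.Properties using (_≟_)
open import Data.Bool using (Bool; true; false; if_then_else_; _∨_; _∧_)
open import Data.List using (map; allFin)
open import Data.Nat.ListAction using (sum)
open import Data.Product using (Σ; _×_; _,_)
open import Relation.Nullary using (¬_; does)
open import Relation.Binary.PropositionalEquality using (_≡_)

record Graph (n : ℕ) : Set where
  field
    adj   : Fin n → Fin n → Bool
    sym   : ∀ x y → adj x y ≡ adj y x
    irrefl : ∀ x → adj x x ≡ false
open Graph public

-- An edge-coloring: colors in ℕ assigned to (unordered) pairs; only the
-- values on edges are relevant.
record Coloring (n : ℕ) : Set where
  field
    col    : Fin n → Fin n → ℕ
    colSym : ∀ x y → col x y ≡ col y x
open Coloring public

deg : ∀ {n} → Graph n → Fin n → ℕ
deg {n} G u = sum (map (λ x → if adj G u x then 1 else 0) (allFin n))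

next : ∀ {r} .{{_ : NonZero r}} → Fin r → Fin r
next {r} i = fromℕ< (m%n<n (suc (toℕ i)) r)

Injective : ∀ {A B : Set} → (A → B) → Set
Injective f = ∀ i j → f i ≡ f j → i ≡ j

IsCycle : ∀ {n} (r : ℕ) .{{_ : NonZero r}} → Graph n → (Fin r → Fin n) → Set
IsCycle r G f = Injective f × (∀ i → adj G (f i) (f (next i)) ≡ true)

HasRainbowCycle : ∀ {n} (r : ℕ) .{{_ : NonZero r}} → Graph n → Coloring n → Set
HasRainbowCycle {n} r G c =
  3 ≤ r × Σ (Fin r → Fin n) (λ f → IsCycle r G f × Injective (λ i → col c (f i) (f (next i))))

samePair : ∀ {n} → Fin n → Fin n → Fin n → Fin n → Bool
samePair x y a b = (does (a ≟ x) ∧ does (b ≟ y)) ∨ (does (a ≟ y) ∧ does (b ≟ x))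

addEdge : ∀ {n} (G : Graph n) (x y : Fin n) → ¬ x ≡ y → Graph n
addEdge G x y x≢y = record
  { adj = λ a b → adj G a b ∨ samePair x y a b
  ; sym = symP
  ; irrefl = irrP }
  where
  open import Data.Bool.Properties using (∨-comm; ∧-comm)
  open import Relation.Binary.PropositionalEquality using (cong₂; refl; trans)
  open import Relation.Nullary using (yes; no)
  open import Data.Empty using (⊥-elim)
  sp : ∀ a b → samePair x y a b ≡ samePair x y b a
  sp a b rewrite ∧-comm (does (a ≟ x)) (does (b ≟ y)) | ∧-comm (does (a ≟ y)) (does (b ≟ x))
    = ∨-comm (does (b ≟ y) ∧ does (a ≟ x)) (does (b ≟ x) ∧ does (a ≟ y))
  symP : ∀ a b → (adj G a b ∨ samePair x y a b) ≡ (adj G b a ∨ samePair x y b a)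
  symP a b = cong₂ _∨_ (sym G a b) (sp a b)
  irrP : ∀ a → (adj G a a ∨ samePair x y a a) ≡ false
  irrP a rewrite irrefl G a with a ≟ x | a ≟ y
  ... | yes refl | yes refl = ⊥-elim (x≢y refl)
  ... | yes _ | no _ = refl
  ... | no _ | yes _ = refl
  ... | no _ | no _ = refl

addColor : ∀ {n} (c : Coloring n) (x y : Fin n) (k : ℕ) → Coloring n
addColor c x y k = record
  { col = λ a b → if samePair x y a b then k else col c a b
  ; colSym = symC }
  where
  open import Data.Bool.Properties using (∨-comm; ∧-comm)
  open import Relation.Binary.PropositionalEquality using (cong₂; refl)
  sp : ∀ a b → samePair x y a b ≡ samePair x y b a
  sp a b rewrite ∧-comm (does (a ≟ x)) (does (b ≟ y)) | ∧-comm (does (a ≟ y)) (does (b ≟ x))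
    = ∨-comm (does (b ≟ y) ∧ does (a ≟ x)) (does (b ≟ x) ∧ does (a ≟ y))
  symC : ∀ a b → (if samePair x y a b then k else col c a b) ≡ (if samePair x y b a then k else col c b a)
  symC a b rewrite sp a b | colSym c a b = refl

RainbowSaturated : ∀ {n} (r : ℕ) .{{_ : NonZero r}} → Graph n → Coloring n → Set
RainbowSaturated r G c =
  ¬ HasRainbowCycle r G c ×
  (∀ x y → (x≢y : ¬ x ≡ y) → adj G x y ≡ false → (k : ℕ) →
     HasRainbowCycle r (addEdge G x y x≢y) (addColor c x y k))

-- Suppose d(v) ≤ 2 but vw is not an edge. Then there is a non-edge ab and vertices p, q with
-- N(a) ⊆ {p, q} and N(p) ⊆ {a, b}: take (a, b, p, q) = (v, w, u, u) if N(v) = {u}, and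
-- (u, x, v, w) if N(v) = {u, x} with x ≠ u. Give the new edge ab the colour of aq. A rainbow
-- C_r in G + ab (r ≥ 4) must use ab, and the other cycle neighbour y of a is adjacent to a in G:
-- y = q repeats the colour of ab, while y = p forces the other cycle neighbour of p into {a, b},
-- closing a triangle. This contradicts saturation, so vw is an edge and d(v) ≤ 2 gives
-- N(v) = {u, w}.
module Submission where

open import Defs renaming (sym to adj-sym)
open import Data.Bool using (true; false; if_then_else_)
open import Data.Bool.Properties using (¬-not) renaming (_≟_ to _≟ᵇ_)
open import Data.Fin using (Fin; zero; suc; toℕ)
open import Data.Fin.Properties using (toℕ-fromℕ<; toℕ-injective; toℕ<n; _≟_; any?)
open import Data.List using (tabulate)
open import Data.List.Properties using (map-tabulate)
open import Data.Nat using (ℕ; zero; suc; _+_; _*_; _∸_; _≤_; _<_; _≥_; _≤?_; NonZero; s≤s; z≤n)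
open import Data.Nat.Properties
  using (≤-refl; ≤-antisym; ≤-pred; ≤-trans; n≤1+n; 1+n≰n; ≰⇒>; <⇒≱; m≤m+n; m≤n+m; +-mono-≤;
         +-comm; +-cancelˡ-≡; m+[n∸m]≡n)
open import Data.Nat.DivMod using (_%_; _/_; %-distribˡ-+; m%n%n≡m%n; m<n⇒m%n≡m; [m+n]%n≡m%n; m≡m%n+[m/n]*n)
open import Data.Nat.Divisibility using (divides; ∣⇒≤)
open import Data.Nat.ListAction using (sum)
open import Data.Product using (_×_; _,_; proj₁)
open import Data.Sum using (_⊎_; inj₁; inj₂; [_,_]′)
open import Function using (_∘_; id)
open import Function.Bundles using (_⇔_; mk⇔; Equivalence)
open import Relation.Nullary using (¬_; contradiction; proof; yes; no; ¬?; _×-dec_)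
open import Relation.Nullary.Decidable using (decidable-stable)
open import Relation.Nullary.Reflects using (Reflects; ofʸ; ofⁿ; invert; det; _×-reflects_; _⊎-reflects_)
open import Relation.Binary.PropositionalEquality
  using (_≡_; _≢_; refl; sym; trans; cong; cong-app; subst; subst₂; module ≡-Reasoning)

module _ {r : ℕ} .{{_ : NonZero r}} where
  open import Function.Endo.Propositional (Fin r) using (_^_; ^-homo) public

  suc[m%n]%n≡suc[m]%n : ∀ m → suc (m % r) % r ≡ suc m % r
  suc[m%n]%n≡suc[m]%n m = begin
    (1 + m % r) % r            ≡⟨ %-distribˡ-+ 1 (m % r) r ⟩
    (1 % r + m % r % r) % r    ≡⟨ cong (λ k → (1 % r + k) % r) (m%n%n≡m%n m r) ⟩
    (1 % r + m % r) % r        ≡⟨ %-distribˡ-+ 1 m r ⟨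
    (1 + m) % r                ∎
    where open ≡-Reasoning

  toℕ-next : ∀ i → toℕ (next i) ≡ suc (toℕ i) % r
  toℕ-next i = toℕ-fromℕ< _

  toℕ-next^ : ∀ m i → toℕ ((next ^ m) i) ≡ (m + toℕ i) % r
  toℕ-next^ zero    i = sym (m<n⇒m%n≡m (toℕ<n i))
  toℕ-next^ (suc m) i = begin
    toℕ (next ((next ^ m) i))      ≡⟨ toℕ-next ((next ^ m) i) ⟩
    suc (toℕ ((next ^ m) i)) % r   ≡⟨ cong (λ k → suc k % r) (toℕ-next^ m i) ⟩
    suc ((m + toℕ i) % r) % r      ≡⟨ suc[m%n]%n≡suc[m]%n (m + toℕ i) ⟩
    suc (m + toℕ i) % r            ∎
    where open ≡-Reasoning

  next^r≡id : ∀ i → (next ^ r) i ≡ i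
  next^r≡id i = toℕ-injective (begin
    toℕ ((next ^ r) i)   ≡⟨ toℕ-next^ r i ⟩
    (r + toℕ i) % r      ≡⟨ cong (_% r) (+-comm r (toℕ i)) ⟩
    (toℕ i + r) % r      ≡⟨ [m+n]%n≡m%n (toℕ i) r ⟩
    toℕ i % r            ≡⟨ m<n⇒m%n≡m (toℕ<n i) ⟩
    toℕ i                ∎)
    where open ≡-Reasoning

  next^-≢ : ∀ {m} i → suc m < r → (next ^ suc m) i ≢ i
  next^-≢ {m} i 1+m<r next^i≡i = <⇒≱ 1+m<r (∣⇒≤ (divides q m≡qr))
    where
    open ≡-Reasoning
    t : ℕ
    t = toℕ i
    q : ℕ
    q = (suc m + t) / r
    m≡qr : suc m ≡ q * r
    m≡qr = +-cancelˡ-≡ t (suc m) (q * r) (begin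
      t + suc m                        ≡⟨ +-comm t (suc m) ⟩
      suc m + t                        ≡⟨ m≡m%n+[m/n]*n (suc m + t) r ⟩
      (suc m + t) % r + q * r          ≡⟨ cong (_+ q * r) (toℕ-next^ (suc m) i) ⟨
      toℕ ((next ^ suc m) i) + q * r   ≡⟨ cong (λ k → toℕ k + q * r) next^i≡i ⟩
      t + q * r                        ∎)

  next^-section : ∀ {m} j → m ≤ r → (next ^ m) ((next ^ (r ∸ m)) j) ≡ j
  next^-section {m} j m≤r = begin
    (next ^ m) ((next ^ (r ∸ m)) j)   ≡⟨ cong-app (^-homo next m (r ∸ m)) j ⟨
    (next ^ (m + (r ∸ m))) j          ≡⟨ cong (λ k → (next ^ k) j) (m+[n∸m]≡n m≤r) ⟩
    (next ^ r) j                      ≡⟨ next^r≡id j ⟩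
    j                                 ∎
    where open ≡-Reasoning

SamePair : ∀ {n} → Fin n → Fin n → Fin n → Fin n → Set
SamePair x y a b = (a ≡ x × b ≡ y) ⊎ (a ≡ y × b ≡ x)

¬SamePair : ∀ {n} {x y s t : Fin n} → s ≢ x → s ≢ y → ¬ SamePair x y s t
¬SamePair s≢x s≢y = [ s≢x ∘ proj₁ , s≢y ∘ proj₁ ]′

module _ {n : ℕ} {x y a b : Fin n} where

  samePair-reflects : Reflects (SamePair x y a b) (samePair x y a b)
  samePair-reflects =
    (proof (a ≟ x) ×-reflects proof (b ≟ y)) ⊎-reflects (proof (a ≟ y) ×-reflects proof (b ≟ x))

  samePair-true⇒ : samePair x y a b ≡ true → SamePair x y a b
  samePair-true⇒ eq = invert (subst (Reflects _) eq samePair-reflects)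

  ¬SamePair⇒samePair-false : ¬ SamePair x y a b → samePair x y a b ≡ false
  ¬SamePair⇒samePair-false ¬p = det samePair-reflects (ofⁿ ¬p)

samePair-refl : ∀ {n} (x y : Fin n) → samePair x y x y ≡ true
samePair-refl x y = det (samePair-reflects {x = x} {y = y}) (ofʸ (inj₁ (refl , refl)))

adj⇒≢ : ∀ {n} (H : Graph n) {s t} → adj H s t ≡ true → s ≢ t
adj⇒≢ H {s} s~t refl = contradiction (trans (sym (irrefl H s)) s~t) λ ()

NeighboursAmong : ∀ {n} → Graph n → Fin n → Fin n → Fin n → Set
NeighboursAmong G v x y = ∀ z → adj G v z ≡ true → z ≡ x ⊎ z ≡ y

module _ {n : ℕ} (G : Graph n) {x y : Fin n} (x≢y : x ≢ y) where

  addEdge-adj : ∀ {a b} → adj (addEdge G x y x≢y) a b ≡ true → ¬ SamePair x y a b → adj G a b ≡ true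
  addEdge-adj {a} {b} a~b ¬p with adj G a b
  ... | true  = refl
  ... | false = contradiction (samePair-true⇒ a~b) ¬p

module _ {n : ℕ} (c : Coloring n) {x y : Fin n} (k : ℕ) where

  addColor-new : col (addColor c x y k) x y ≡ k
  addColor-new = cong (if_then k else col c x y) (samePair-refl x y)

  addColor-old : ∀ {a b} → ¬ SamePair x y a b → col (addColor c x y k) a b ≡ col c a b
  addColor-old {a} {b} ¬p = cong (if_then k else col c a b) (¬SamePair⇒samePair-false ¬p)

-- z – y – a – b: the two vertices preceding a on a rainbow cycle through the edge ab.
record PathInto {n} (H : Graph n) (d : Coloring n) (a b : Fin n) : Set where
  field
    {z y}           : Fin n
    z~y             : adj H z y ≡ true
    y~a             : adj H y a ≡ true
    y≢b             : y ≢ b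
    z≢a             : z ≢ a
    z≢b             : z ≢ b
    col[ya]≢col[ab] : col d y a ≢ col d a b

module _ {n r : ℕ} .{{_ : NonZero r}} (4≤r : 4 ≤ r) {H : Graph n} {d : Coloring n} {f : Fin r → Fin n}
         (f-injective : Injective f) (f-adj : ∀ i → adj H (f i) (f (next i)) ≡ true)
         (rainbow : Injective (λ i → col d (f i) (f (next i)))) where

  private
    next≢ : ∀ i → next i ≢ i
    next≢ i = next^-≢ i (≤-trans (s≤s (s≤s z≤n)) 4≤r)
    next²≢ : ∀ i → next (next i) ≢ i
    next²≢ i = next^-≢ i (≤-trans (s≤s (s≤s (s≤s z≤n))) 4≤r)
    next³≢ : ∀ i → next (next (next i)) ≢ i
    next³≢ i = next^-≢ i 4≤r

    f-≢ : ∀ {i j} → i ≢ j → f i ≢ f j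
    f-≢ i≢j = i≢j ∘ f-injective _ _

    pathInto-window : ∀ i → PathInto H d (f (next (next i))) (f (next (next (next i))))
    pathInto-window i = record
      { z~y = f-adj i
      ; y~a = f-adj (next i)
      ; y≢b = f-≢ (next²≢ (next i) ∘ sym)
      ; z≢a = f-≢ (next²≢ i ∘ sym)
      ; z≢b = f-≢ (next³≢ i ∘ sym)
      ; col[ya]≢col[ab] = next≢ (next i) ∘ sym ∘ rainbow _ _
      }

  pathInto-edge : ∀ j → PathInto H d (f j) (f (next j))
  pathInto-edge j = subst (λ i → PathInto H d (f i) (f (next i)))
    (next^-section j (≤-trans (s≤s (s≤s z≤n)) 4≤r)) (pathInto-window ((next ^ (r ∸ 2)) j))

  pathInto-edge-reversed : ∀ i → PathInto H d (f (next i)) (f i)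
  pathInto-edge-reversed i = record
    { z~y = trans (adj-sym H _ _) (f-adj (next (next i)))
    ; y~a = trans (adj-sym H _ _) (f-adj (next i))
    ; y≢b = f-≢ (next²≢ i)
    ; z≢a = f-≢ (next²≢ (next i))
    ; z≢b = f-≢ (next³≢ i)
    ; col[ya]≢col[ab] = λ eq → next≢ i (rainbow _ _ (trans (colSym d _ _) (trans eq (colSym d _ _))))
    }

module _ {n : ℕ} (G : Graph n) (c : Coloring n) {a b p q : Fin n} (a≢b : a ≢ b)
         (N[a]⊆pq : NeighboursAmong G a p q) (N[p]⊆ab : NeighboursAmong G p a b) where

  private
    G⁺ : Graph n
    G⁺ = addEdge G a b a≢b
    c⁺ : Coloring n
    c⁺ = addColor c a b (col c a q)

  ¬pathInto-addEdge : ¬ PathInto G⁺ c⁺ a b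
  ¬pathInto-addEdge P = [ y≢p , y≢q ]′ (N[a]⊆pq y (trans (adj-sym G a y) y~ᴳa))
    where
    open PathInto P
    ¬SamePair[ya] : ¬ SamePair a b y a
    ¬SamePair[ya] = ¬SamePair (adj⇒≢ G⁺ y~a) y≢b
    y~ᴳa : adj G y a ≡ true
    y~ᴳa = addEdge-adj G a≢b y~a ¬SamePair[ya]
    y≢p : y ≢ p
    y≢p y≡p = [ z≢a , z≢b ]′ (N[p]⊆ab z (subst (λ v → adj G v z ≡ true) y≡p (trans (adj-sym G y z) z~ᴳy)))
      where
      z~ᴳy : adj G z y ≡ true
      z~ᴳy = addEdge-adj G a≢b z~y (¬SamePair z≢a z≢b)
    y≢q : y ≢ q
    y≢q y≡q = col[ya]≢col[ab] (begin
      col c⁺ y a    ≡⟨ addColor-old c (col c a q) ¬SamePair[ya] ⟩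
      col c y a     ≡⟨ colSym c y a ⟩
      col c a y     ≡⟨ cong (col c a) y≡q ⟩
      col c a q     ≡⟨ addColor-new c (col c a q) ⟨
      col c⁺ a b    ∎)
      where open ≡-Reasoning

  addEdge-¬rainbowCycle : ∀ {r} .{{_ : NonZero r}} → 4 ≤ r → ¬ HasRainbowCycle r G c → ¬ HasRainbowCycle r G⁺ c⁺
  addEdge-¬rainbowCycle 4≤r ¬cycle (3≤r , f , (f-injective , f-adj⁺) , rainbow⁺) =
    ¬cycle (3≤r , f , (f-injective , f-adj) , rainbow)
    where
    oldEdge : ∀ i → ¬ SamePair a b (f i) (f (next i))
    oldEdge i (inj₁ (fi≡a , f[next-i]≡b)) = ¬pathInto-addEdge
      (subst₂ (PathInto G⁺ c⁺) fi≡a f[next-i]≡b (pathInto-edge 4≤r f-injective f-adj⁺ rainbow⁺ i))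
    oldEdge i (inj₂ (fi≡b , f[next-i]≡a)) = ¬pathInto-addEdge
      (subst₂ (PathInto G⁺ c⁺) f[next-i]≡a fi≡b (pathInto-edge-reversed 4≤r f-injective f-adj⁺ rainbow⁺ i))
    f-adj : ∀ i → adj G (f i) (f (next i)) ≡ true
    f-adj i = addEdge-adj G a≢b (f-adj⁺ i) (oldEdge i)
    rainbow : Injective (λ i → col c (f i) (f (next i)))
    rainbow i j eq = rainbow⁺ i j
      (trans (addColor-old c _ (oldEdge i)) (trans eq (sym (addColor-old c _ (oldEdge j)))))

  ¬rainbowSaturated : ∀ {r} .{{_ : NonZero r}} → 4 ≤ r → adj G a b ≡ false → ¬ RainbowSaturated r G c
  ¬rainbowSaturated 4≤r a≁b (¬cycle , saturated) =
    addEdge-¬rainbowCycle 4≤r ¬cycle (saturated a b a≢b a≁b (col c a q))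

h≤sum-tabulate : ∀ {n} (h : Fin n → ℕ) a → h a ≤ sum (tabulate h)
h≤sum-tabulate h zero    = m≤m+n _ _
h≤sum-tabulate h (suc a) = ≤-trans (h≤sum-tabulate (h ∘ suc) a) (m≤n+m _ _)

2≤sum-tabulate : ∀ {n} (h : Fin n → ℕ) {a b} → a ≢ b → 1 ≤ h a → 1 ≤ h b → 2 ≤ sum (tabulate h)
2≤sum-tabulate h {zero}  {zero}  a≢b _  _  = contradiction refl a≢b
2≤sum-tabulate h {zero}  {suc b} _   ha hb = +-mono-≤ ha (≤-trans hb (h≤sum-tabulate (h ∘ suc) b))
2≤sum-tabulate h {suc a} {zero}  _   ha hb = +-mono-≤ hb (≤-trans ha (h≤sum-tabulate (h ∘ suc) a))
2≤sum-tabulate h {suc a} {suc b} a≢b ha hb =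
  ≤-trans (2≤sum-tabulate (h ∘ suc) (a≢b ∘ cong suc) ha hb) (m≤n+m _ _)

3≤sum-tabulate : ∀ {n} (h : Fin n → ℕ) {a b c} → a ≢ b → a ≢ c → b ≢ c →
                 1 ≤ h a → 1 ≤ h b → 1 ≤ h c → 3 ≤ sum (tabulate h)
3≤sum-tabulate h {zero}  {zero}  {_}     a≢b _   _   _  _  _  = contradiction refl a≢b
3≤sum-tabulate h {zero}  {suc _} {zero}  _   a≢c _   _  _  _  = contradiction refl a≢c
3≤sum-tabulate h {suc _} {zero}  {zero}  _   _   b≢c _  _  _  = contradiction refl b≢c
3≤sum-tabulate h {zero}  {suc b} {suc c} _   _   b≢c ha hb hc =
  +-mono-≤ ha (2≤sum-tabulate (h ∘ suc) (b≢c ∘ cong suc) hb hc)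
3≤sum-tabulate h {suc a} {zero}  {suc c} _   a≢c _   ha hb hc =
  +-mono-≤ hb (2≤sum-tabulate (h ∘ suc) (a≢c ∘ cong suc) ha hc)
3≤sum-tabulate h {suc a} {suc b} {zero}  a≢b _   _   ha hb hc =
  +-mono-≤ hc (2≤sum-tabulate (h ∘ suc) (a≢b ∘ cong suc) ha hb)
3≤sum-tabulate h {suc a} {suc b} {suc c} a≢b a≢c b≢c ha hb hc =
  ≤-trans (3≤sum-tabulate (h ∘ suc) (a≢b ∘ cong suc) (a≢c ∘ cong suc) (b≢c ∘ cong suc) ha hb hc) (m≤n+m _ _)

module _ {n : ℕ} (G : Graph n) (v : Fin n) where

  private
    indicator : Fin n → ℕ
    indicator x = if adj G v x then 1 else 0

    deg≡sum-tabulate : deg G v ≡ sum (tabulate indicator)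
    deg≡sum-tabulate = cong sum (map-tabulate id indicator)

    1≤indicator : ∀ {x} → adj G v x ≡ true → 1 ≤ indicator x
    1≤indicator v~x rewrite v~x = ≤-refl

  2≤deg : ∀ {a b} → a ≢ b → adj G v a ≡ true → adj G v b ≡ true → 2 ≤ deg G v
  2≤deg a≢b v~a v~b rewrite deg≡sum-tabulate =
    2≤sum-tabulate indicator a≢b (1≤indicator v~a) (1≤indicator v~b)

  3≤deg : ∀ {a b c} → a ≢ b → a ≢ c → b ≢ c →
          adj G v a ≡ true → adj G v b ≡ true → adj G v c ≡ true → 3 ≤ deg G v
  3≤deg a≢b a≢c b≢c v~a v~b v~c rewrite deg≡sum-tabulate =
    3≤sum-tabulate indicator a≢b a≢c b≢c (1≤indicator v~a) (1≤indicator v~b) (1≤indicator v~c)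

  deg<3⇒neighboursAmong : ∀ {a b} → deg G v < 3 → a ≢ b → adj G v a ≡ true → adj G v b ≡ true →
                          NeighboursAmong G v a b
  deg<3⇒neighboursAmong {a} {b} deg<3 a≢b v~a v~b x v~x with x ≟ a | x ≟ b
  ... | yes x≡a | _       = inj₁ x≡a
  ... | no  _   | yes x≡b = inj₂ x≡b
  ... | no  x≢a | no  x≢b = contradiction (3≤deg a≢b (x≢a ∘ sym) (x≢b ∘ sym) v~a v~b v~x) (<⇒≱ deg<3)

module _ {n r : ℕ} .{{_ : NonZero r}} (G : Graph n) (c : Coloring n) (4≤r : 4 ≤ r)
         (saturated : RainbowSaturated r G c) {u v w : Fin n} (v≢w : v ≢ w)
         (N[u]≡vw : ∀ x → (adj G u x ≡ true) ⇔ (x ≡ v ⊎ x ≡ w)) (deg[v]<3 : deg G v < 3) where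

  private
    N[u]⊆vw : NeighboursAmong G u v w
    N[u]⊆vw x = Equivalence.to (N[u]≡vw x)
    u~w : adj G u w ≡ true
    u~w = Equivalence.from (N[u]≡vw w) (inj₂ refl)
    v~u : adj G v u ≡ true
    v~u = trans (adj-sym G v u) (Equivalence.from (N[u]≡vw v) (inj₁ refl))

  v~w : adj G v w ≡ true
  v~w = ¬-not ¬v≁w
    where
    ¬v≁w : adj G v w ≢ false
    ¬v≁w v≁w with any? (λ x → (adj G v x ≟ᵇ true) ×-dec ¬? (x ≟ u))
    ... | no ∄x = ¬rainbowSaturated G c v≢w N[v]⊆uu N[u]⊆vw 4≤r v≁w saturated
      where
      N[v]⊆uu : NeighboursAmong G v u u
      N[v]⊆uu x v~x = inj₁ (decidable-stable (x ≟ u) λ x≢u → ∄x (x , v~x , x≢u))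
    ... | yes (x , v~x , x≢u) = ¬rainbowSaturated G c (x≢u ∘ sym) N[u]⊆vw N[v]⊆ux 4≤r u≁x saturated
      where
      N[v]⊆ux : NeighboursAmong G v u x
      N[v]⊆ux = deg<3⇒neighboursAmong G v deg[v]<3 (x≢u ∘ sym) v~u v~x
      x≢w : x ≢ w
      x≢w x≡w = contradiction (trans (sym v≁w) (trans (cong (adj G v) (sym x≡w)) v~x)) λ ()
      u≁x : adj G u x ≡ false
      u≁x = ¬-not λ u~x → [ adj⇒≢ G v~x ∘ sym , x≢w ]′ (N[u]⊆vw x u~x)

  N[v]≡uw : ∀ x → (adj G v x ≡ true) ⇔ (x ≡ u ⊎ x ≡ w)
  N[v]≡uw x = mk⇔ (deg<3⇒neighboursAmong G v deg[v]<3 (adj⇒≢ G u~w) v~u v~w x)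
                  λ { (inj₁ refl) → v~u ; (inj₂ refl) → v~w }

  deg[v]≡2 : deg G v ≡ 2
  deg[v]≡2 = ≤-antisym (≤-pred deg[v]<3) (2≤deg G v (adj⇒≢ G u~w) v~u v~w)

proposition7p1 : (n r : ℕ) .{{_ : NonZero r}} → 5 ≤ r → r ≤ n →
    (G : Graph n) (c : Coloring n) → RainbowSaturated r G c →
    (u v w : Fin n) → deg G u ≡ 2 → ¬ v ≡ w →
    (∀ x → (adj G u x ≡ true) ⇔ (x ≡ v ⊎ x ≡ w)) → deg G v ≤ deg G w →
    (deg G v ≥ 3 × ¬ (deg G v ≡ 2 × (∀ x → (adj G v x ≡ true) ⇔ (x ≡ u ⊎ x ≡ w))))
    ⊎ (¬ (deg G v ≥ 3) × (deg G v ≡ 2 × (∀ x → (adj G v x ≡ true) ⇔ (x ≡ u ⊎ x ≡ w))))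
proposition7p1 n r 5≤r _ G c saturated u v w _ v≢w N[u]≡vw _ with 3 ≤? deg G v
... | yes 3≤deg = inj₁ (3≤deg , λ (deg≡2 , _) → 1+n≰n (subst (3 ≤_) deg≡2 3≤deg))
... | no  3≰deg = inj₂ (3≰deg , deg[v]≡2 G c 4≤r saturated v≢w N[u]≡vw deg<3
                                , N[v]≡uw G c 4≤r saturated v≢w N[u]≡vw deg<3)
  where
  4≤r : 4 ≤ r
  4≤r = ≤-trans (n≤1+n 4) 5≤r
  deg<3 : deg G v < 3
  deg<3 = ≰⇒> 3≰deg
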